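{- Let $G$ be a simple bipartite edge-magic graph with stable sets $X=\{x_i\}_{i=1}^s$ and $Y=\{y_j\}_{j=1}^t$, and suppose $G\cong H_1\oplus H_2$ is a decomposition of $G$. Then $\lim_{n\to\infty}|\tau_{S_{2n}(G;H_1,H_2)}|=\infty$.
   Context: A decomposition $G\cong H_1\oplus H_2$ means $H_1,H_2$ are subgraphs of $G$ whose edge sets partition $E(G)$. An edge-magic labeling of a graph with $p$ vertices and $q$ edges is a bijection $f:V\cup E\to[1,p+q]$ such that $f(x)+f(xy)+f(y)$ is a constant (the valence) over all edges $xy$; here $[a,b]=\{a,\dots,b\}$. Let $T_G=\{(\sum_{u\in V}\deg(u)g(u)+\sum_{e\in E}g(e))/q: g:V\cup E\to[1,p+q]\text{ bijective}\}$, $J_G=[\lceil\min T_G\rceil,\lfloor\max T_G\rfloor]$ and $\tau_G=\{k\in J_G: k\text{ is the valence of some edge-magic labeling of }G\}$. $S_{2n}(G;H_1,H_2)$ is the graph with vertex set $X\cup Y\cup\bigcup_{k=1}^n X_k\cup\bigcup_{k=1}^n Y_k$, where $X_k=\{x_i^k\}_{i=1}^s$, $Y_k=\{y_j^k\}_{j=1}^t$ are new vertices, and edge set $E(G)\cup\{x_iy_j^k: x_iy_j\in E(H_1),\,k\in[1,n]\}\cup\{x_i^ky_j: x_iy_j\in E(H_2),\,k\in[1,n]\}$. -}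

module Defs where

open import Data.Nat using (ℕ; zero; suc; _+_; _*_; _≤_)
open import Data.Fin using (Fin; toℕ; _↑ˡ_; _↑ʳ_; splitAt; remQuot; combine; _≟_)
open import Data.Bool using (Bool; true; false; if_then_else_)
open import Data.Sum using (_⊎_; inj₁; inj₂)
open import Data.Product using (Σ; ∃; _×_; _,_; proj₁; proj₂)
open import Relation.Nullary using (does)
open import Relation.Binary.PropositionalEquality using (_≡_)
open import Function.Bundles using (_⤖_; Bijection)
open import Function.Definitions using (Injective)

sumFin : (n : ℕ) → (Fin n → ℕ) → ℕ
sumFin zero    f = 0
sumFin (suc n) f = f Fin.zero + sumFin n (λ i → f (Fin.suc i))

record Graph : Set where
  field
    p    : ℕ
    q    : ℕ
    ends : Fin q → Fin p × Fin p
open Graph public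

indicator : ∀ {m} → Fin m → Fin m → ℕ
indicator u v = if does (u ≟ v) then 1 else 0

-- degree of u (a loop would count twice)
deg : (G : Graph) → Fin (p G) → ℕ
deg G u = sumFin (q G) (λ e → indicator u (proj₁ (ends G e)) + indicator u (proj₂ (ends G e)))

-- a bijection g : V ∪ E → [1, p+q]; the label of x is suc (toℕ (g x))
Labeling : Graph → Set
Labeling G = (Fin (p G) ⊎ Fin (q G)) ⤖ Fin (p G + q G)

lab : (G : Graph) → Labeling G → (Fin (p G) ⊎ Fin (q G)) → ℕ
lab G g x = suc (toℕ (Bijection.to g x))

IsEdgeMagic : (G : Graph) → Labeling G → ℕ → Set
IsEdgeMagic G f k = ∀ (e : Fin (q G)) →
  lab G f (inj₁ (proj₁ (ends G e))) + lab G f (inj₂ e) + lab G f (inj₁ (proj₂ (ends G e))) ≡ k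

EdgeMagic : Graph → Set
EdgeMagic G = Σ (Labeling G) λ f → Σ ℕ λ k → IsEdgeMagic G f k

-- q · (element of T_G) for the bijection g
weight : (G : Graph) → Labeling G → ℕ
weight G g = sumFin (p G) (λ u → deg G u * lab G g (inj₁ u)) + sumFin (q G) (λ e → lab G g (inj₂ e))

-- k ∈ J_G = [⌈min T_G⌉, ⌊max T_G⌋]  (for integer k: min T_G ≤ k ≤ max T_G)
InJ : Graph → ℕ → Set
InJ G k = (Σ (Labeling G) λ g → weight G g ≤ q G * k) × (Σ (Labeling G) λ g → q G * k ≤ weight G g)

InTau : Graph → ℕ → Set
InTau G k = InJ G k × (Σ (Labeling G) λ f → IsEdgeMagic G f k)

AtLeast : ℕ → (ℕ → Set) → Set
AtLeast M P = Σ (Fin M → ℕ) λ v → Injective _≡_ _≡_ v × (∀ i → P (v i))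

-- A simple bipartite graph with stable sets X = Fin s, Y = Fin t and
-- q edges; edge e is x_i y_j where edge e = (i , j).  Simplicity = injectivity.
record BipGraph (s t : ℕ) : Set where
  field
    nE     : ℕ
    edge   : Fin nE → Fin s × Fin t
    simple : Injective _≡_ _≡_ edge
open BipGraph public

-- G as a graph: vertices x_i ↦ i, y_j ↦ s + j
toGraph : ∀ {s t} → BipGraph s t → Graph
toGraph {s} {t} B = record
  { p = s + t ; q = nE B
  ; ends = λ e → (proj₁ (edge B e) ↑ˡ t) , (s ↑ʳ proj₂ (edge B e)) }

-- A decomposition G ≅ H₁ ⊕ H₂: each edge is assigned to H₁ (true) or H₂ (false)
Decomposition : ∀ {s t} → BipGraph s t → Set
Decomposition B = Fin (nE B) → Bool

-- S_{2n}(G;H₁,H₂).  Vertices: X, Y, X_1..X_n, Y_1..Y_n laid out as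
-- (s + t) + (n*s + n*t).  Edges: E(G) followed by n copies (Fin (n * q)).
S2n : ∀ {s t} (B : BipGraph s t) → Decomposition B → ℕ → Graph
S2n {s} {t} B H n = record { p = (s + t) + (n * s + n * t) ; q = nE B + n * nE B ; ends = ends' }
  where
    R = n * s + n * t
    xV : Fin s → Fin ((s + t) + R)
    xV i = (i ↑ˡ t) ↑ˡ R
    yV : Fin t → Fin ((s + t) + R)
    yV j = (s ↑ʳ j) ↑ˡ R
    xK : Fin n → Fin s → Fin ((s + t) + R)
    xK k i = (s + t) ↑ʳ (combine k i ↑ˡ (n * t))
    yK : Fin n → Fin t → Fin ((s + t) + R)
    yK k j = (s + t) ↑ʳ ((n * s) ↑ʳ combine k j)
    copy : Fin n → Fin (nE B) → Fin ((s + t) + R) × Fin ((s + t) + R)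
    copy k e with H e
    ... | true  = xV (proj₁ (edge B e)) , yK k (proj₂ (edge B e))
    ... | false = xK k (proj₁ (edge B e)) , yV (proj₂ (edge B e))
    ends' : Fin (nE B + n * nE B) → Fin ((s + t) + R) × Fin ((s + t) + R)
    ends' e with splitAt (nE B) e
    ... | inj₁ e₀ = xV (proj₁ (edge B e₀)) , yV (proj₂ (edge B e₀))
    ... | inj₂ r  = copy (proj₁ (remQuot {n} (nE B) r)) (proj₂ (remQuot {n} (nE B) r))

module Submission where

-- The elements (vertices and edges) of S = S₂ₙ(G;H₁,H₂) are n+1 layered copies
-- of the elements of G: layer 0 is G itself, and layer k holds the k-th copies of the
-- edges together with the vertices X_k ∪ Y_k.  Every edge of S lies over an edge x y of
-- G; if the edge is in layer a, then one of its endpoints lies in layer 0 and the other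
-- in layer a.  Given an edge-magic labeling f of G with valence k and a layer d ≤ n, let
-- τ be the transposition (0 d) of the layers and give the copy of u in layer a the label
--   P·τ(a) + f(u)   if u is a vertex,     P·(n - τ(a)) + f(u)   if u is an edge,
-- where P = |V(G)| + |E(G)|.  This is a bijection onto [1,(n+1)P], and every edge of S
-- gets the sum P·(τ(0) + (n - τ(a)) + τ(a)) + k = P(d+n) + k.
-- So S has n+1 distinct magic valences P(d+n)+k, d = 0..n, and by the handshake identity
-- (q times the mean of T_S equals the sum of all edge sums) each valence lies in J_S.

open import Defs
open import Data.Nat using (ℕ; zero; suc; _+_; _*_; _∸_; _≤_; _≥_; _≟_; NonZero; ≢-nonZero)
open import Data.Nat.Properties
open import Data.Nat.Tactic.RingSolver using (solve-∀)
open import Data.Fin as Fin using (Fin; toℕ; _↑ˡ_; _↑ʳ_; splitAt; combine; cast; inject≤)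
open import Data.Fin.Properties
  using (toℕ-injective; toℕ-cast; toℕ-combine; inject≤-injective; toℕ≤pred[n];
         opposite-prop; splitAt-↑ˡ; splitAt-↑ʳ; splitAt⁻¹-↑ˡ; splitAt⁻¹-↑ʳ; remQuot-combine; +↔⊎; *↔×)
open import Data.Fin.Permutation using (Permutation′; _⟨$⟩ʳ_; _⟨$⟩ˡ_; inverseˡ; inverseʳ; transpose; reverse; _∘ₚ_; cast-id; ↔⇒≡)
open import Data.Sum using (_⊎_; inj₁; inj₂; [_,_]′)
open import Data.Sum.Function.Propositional using (_⊎-↔_)
open import Data.Product using (Σ; ∃₂; _×_; _,_; proj₁; proj₂; swap)
open import Data.Product.Algebra using (×-distribˡ-⊎; ×-distribʳ-⊎)
open import Data.Product.Function.NonDependent.Propositional using (_×-↔_)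
open import Data.Bool using (true; false)
open import Data.Empty using (⊥; ⊥-elim)
open import Function.Base using (_∘_)
open import Function.Bundles using (_↔_; Inverse; Bijection; mk↔ₛ′)
open import Function.Construct.Composition using (_↔-∘_)
open import Function.Construct.Identity using (↔-id)
open import Function.Construct.Symmetry using (↔-sym)
open import Function.Properties.Inverse using (↔⇒⤖)
open import Function.Properties.Bijection using (⤖⇒↔)
open import Level using (0ℓ)
open import Relation.Nullary using (yes; no)
open import Relation.Binary.PropositionalEquality

sum-cong : ∀ n {f g : Fin n → ℕ} → (∀ i → f i ≡ g i) → sumFin n f ≡ sumFin n g
sum-cong zero    f≗g = refl
sum-cong (suc n) f≗g = cong₂ _+_ (f≗g Fin.zero) (sum-cong n (f≗g ∘ Fin.suc))

sum-const : ∀ n c → sumFin n (λ _ → c) ≡ n * c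
sum-const zero    c = refl
sum-const (suc n) c = cong (c +_) (sum-const n c)

sum-+ : ∀ n (f g : Fin n → ℕ) → sumFin n (λ i → f i + g i) ≡ sumFin n f + sumFin n g
sum-+ zero    f g = refl
sum-+ (suc n) f g = trans (cong (f Fin.zero + g Fin.zero +_) (sum-+ n (f ∘ Fin.suc) (g ∘ Fin.suc)))
                          (interchange (f Fin.zero) (g Fin.zero) _ _)
  where
  interchange : ∀ a b c d → (a + b) + (c + d) ≡ (a + c) + (b + d)
  interchange = solve-∀

sum-*ʳ : ∀ n (f : Fin n → ℕ) c → sumFin n f * c ≡ sumFin n (λ i → f i * c)
sum-*ʳ zero    f c = refl
sum-*ʳ (suc n) f c = trans (*-distribʳ-+ c (f Fin.zero) _) (cong (f Fin.zero * c +_) (sum-*ʳ n (f ∘ Fin.suc) c))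

sum-swap : ∀ m n (F : Fin m → Fin n → ℕ) →
  sumFin m (λ u → sumFin n (F u)) ≡ sumFin n (λ e → sumFin m (λ u → F u e))
sum-swap zero    n F = sym (trans (sum-const n 0) (*-zeroʳ n))
sum-swap (suc m) n F = trans (cong (sumFin n (F Fin.zero) +_) (sum-swap m n (F ∘ Fin.suc)))
                             (sym (sum-+ n (F Fin.zero) (λ e → sumFin m (λ u → F (Fin.suc u) e))))

sum-indicator : ∀ m (a : Fin m) (h : Fin m → ℕ) → sumFin m (λ u → indicator u a * h u) ≡ h a
sum-indicator (suc m) Fin.zero    h = begin
  h Fin.zero + 0 + sumFin m (λ _ → 0) ≡⟨ cong₂ _+_ (+-identityʳ _) (trans (sum-const m 0) (*-zeroʳ m)) ⟩
  h Fin.zero + 0                       ≡⟨ +-identityʳ _ ⟩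
  h Fin.zero                           ∎
  where open ≡-Reasoning
sum-indicator (suc m) (Fin.suc a) h = sum-indicator m a (h ∘ Fin.suc)

-- The handshake identity and the interval J

Elements : Graph → Set
Elements G = Fin (p G) ⊎ Fin (q G)

edgeLabelSum : (G : Graph) → Labeling G → Fin (q G) → ℕ
edgeLabelSum G g e = lab G g (inj₁ (proj₁ (ends G e))) + lab G g (inj₂ e) + lab G g (inj₁ (proj₂ (ends G e)))

-- Σ_u deg(u) g(u) + Σ_e g(e) = Σ_{xy ∈ E} (g(x) + g(xy) + g(y)): each vertex label is
-- counted once for every incident edge end.
handshake : (G : Graph) (g : Labeling G) → weight G g ≡ sumFin (q G) (edgeLabelSum G g)
handshake G g = begin
  weight G g                                                 ≡⟨ cong (_+ sumFin (q G) edgeLab) degreeSum ⟩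
  sumFin (q G) (λ e → vtx (end₁ e) + vtx (end₂ e)) + sumFin (q G) edgeLab
                                                             ≡⟨ sym (sum-+ (q G) _ _) ⟩
  sumFin (q G) (λ e → vtx (end₁ e) + vtx (end₂ e) + edgeLab e)
                                                             ≡⟨ sum-cong (q G) (λ e → swapLast (vtx (end₁ e)) _ _) ⟩
  sumFin (q G) (edgeLabelSum G g)                            ∎
  where
  open ≡-Reasoning
  swapLast : ∀ a b c → a + b + c ≡ a + c + b
  swapLast = solve-∀
  vtx : Fin (p G) → ℕ
  vtx u = lab G g (inj₁ u)
  edgeLab : Fin (q G) → ℕ
  edgeLab e = lab G g (inj₂ e)
  end₁ end₂ : Fin (q G) → Fin (p G)
  end₁ e = proj₁ (ends G e)
  end₂ e = proj₂ (ends G e)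
  incidence : Fin (p G) → Fin (q G) → ℕ
  incidence u e = indicator u (end₁ e) + indicator u (end₂ e)
  degreeSum : sumFin (p G) (λ u → deg G u * vtx u) ≡ sumFin (q G) (λ e → vtx (end₁ e) + vtx (end₂ e))
  degreeSum = begin
    sumFin (p G) (λ u → deg G u * vtx u)
      ≡⟨ sum-cong (p G) (λ u → sum-*ʳ (q G) (incidence u) (vtx u)) ⟩
    sumFin (p G) (λ u → sumFin (q G) (λ e → incidence u e * vtx u))
      ≡⟨ sum-swap (p G) (q G) _ ⟩
    sumFin (q G) (λ e → sumFin (p G) (λ u → incidence u e * vtx u))
      ≡⟨ sum-cong (q G) (λ e → trans (sum-cong (p G) (λ u → *-distribʳ-+ (vtx u) (indicator u (end₁ e)) _))
                                      (trans (sum-+ (p G) _ _)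
                                             (cong₂ _+_ (sum-indicator (p G) (end₁ e) vtx)
                                                        (sum-indicator (p G) (end₂ e) vtx)))) ⟩
    sumFin (q G) (λ e → vtx (end₁ e) + vtx (end₂ e)) ∎

-- The valence k of an edge-magic labeling f is q·k = weight f, a value of q·T_G; so k ∈ J_G
-- and hence k ∈ τ_G.
magic⇒InTau : (G : Graph) (f : Labeling G) (k : ℕ) → IsEdgeMagic G f k → InTau G k
magic⇒InTau G f k magic = ((f , ≤-reflexive weight≡) , (f , ≤-reflexive (sym weight≡))) , (f , magic)
  where
  weight≡ : weight G f ≡ q G * k
  weight≡ = trans (handshake G f) (trans (sum-cong (q G) magic) (sum-const (q G) k))

edgeless-InTau : (G : Graph) → q G ≡ 0 → Labeling G → ∀ k → InTau G k
edgeless-InTau G noEdges f k = magic⇒InTau G f k (λ e → ⊥-elim (noFin noEdges e))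
  where
  noFin : ∀ {m} → m ≡ 0 → Fin m → ⊥
  noFin refl ()

-- Layered labelings

twist : {A B : Set} {m : ℕ} (F : A ↔ B) (σ : A → Permutation′ m) → (A × Fin m) ↔ (Fin m × B)
twist {A} {B} {m} F σ = mk↔ₛ′ to from to∘from from∘to
  where
  to : A × Fin m → Fin m × B
  to (u , a) = σ u ⟨$⟩ʳ a , Inverse.to F u
  from : Fin m × B → A × Fin m
  from (l , c) = Inverse.from F c , σ (Inverse.from F c) ⟨$⟩ˡ l
  to∘from : ∀ x → to (from x) ≡ x
  to∘from (l , c) = cong₂ _,_ (inverseʳ (σ (Inverse.from F c))) (Inverse.strictlyInverseˡ F c)
  from∘to : ∀ x → from (to x) ≡ x
  from∘to (u , a) rewrite Inverse.strictlyInverseʳ F u = cong (u ,_) (inverseˡ (σ u))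

layeredLabeling : (G S : Graph) (f : Labeling G) {m : ℕ}
  (Φ : Elements S ↔ (Elements G × Fin m)) (σ : Elements G → Permutation′ m) →
  Σ (Labeling S) λ L → ∀ u a →
    lab S L (Inverse.from Φ (u , a)) ≡ (p G + q G) * toℕ (σ u ⟨$⟩ʳ a) + lab G f u
layeredLabeling G S f {m} Φ σ = ↔⇒⤖ (cast-id size ↔-∘ grid) , labelOf
  where
  P : ℕ
  P = p G + q G
  -- element ↦ (σᵤ(a) , f(u)) ↦ P·σᵤ(a) + f(u)
  grid : Elements S ↔ Fin (m * P)
  grid = ↔-sym *↔× ↔-∘ (twist (⤖⇒↔ f) σ ↔-∘ Φ)
  -- both sides count Elements S
  size : m * P ≡ p S + q S
  size = ↔⇒≡ (↔-sym +↔⊎ ↔-∘ ↔-sym grid)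
  labelOf : ∀ u a → suc (toℕ (cast size (Inverse.to grid (Inverse.from Φ (u , a))))) ≡ P * toℕ (σ u ⟨$⟩ʳ a) + lab G f u
  labelOf u a rewrite Inverse.strictlyInverseˡ Φ (u , a) =
    trans (cong suc (trans (toℕ-cast size _) (toℕ-combine (σ u ⟨$⟩ʳ a) (Bijection.to f u))))
          (sym (+-suc _ _))

-- The layer structure of S₂ₙ(G;H₁,H₂)

-- Fin (m + R) as a base copy of Fin m (layer 0) followed by the layers 1..n of Fin R ≅ Fin n × Fin m.
stack : {m n R : ℕ} → (Fin R ↔ (Fin n × Fin m)) → Fin (m + R) ↔ (Fin m × Fin (suc n))
stack {m} {n} {R} c = mk↔ₛ′ to from to∘from from∘to
  where
  raise : Fin n × Fin m → Fin m × Fin (suc n)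
  raise (k , u) = u , Fin.suc k
  decode : Fin m ⊎ Fin R → Fin m × Fin (suc n)
  decode = [ (_, Fin.zero) , raise ∘ Inverse.to c ]′
  to : Fin (m + R) → Fin m × Fin (suc n)
  to v = decode (splitAt m v)
  from : Fin m × Fin (suc n) → Fin (m + R)
  from (u , Fin.zero)  = u ↑ˡ R
  from (u , Fin.suc k) = m ↑ʳ Inverse.from c (k , u)
  to∘from : ∀ x → to (from x) ≡ x
  to∘from (u , Fin.zero)  = cong decode (splitAt-↑ˡ m u R)
  to∘from (u , Fin.suc k) = trans (cong decode (splitAt-↑ʳ m R _))
                                  (cong raise (Inverse.strictlyInverseˡ c (k , u)))
  fromSplit : ∀ v x → splitAt m v ≡ x → from (decode x) ≡ v
  fromSplit v (inj₁ u) eq = splitAt⁻¹-↑ˡ eq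
  fromSplit v (inj₂ r) eq = trans (cong (m ↑ʳ_) (Inverse.strictlyInverseʳ c r)) (splitAt⁻¹-↑ʳ eq)
  from∘to : ∀ v → from (to v) ≡ v
  from∘to v = fromSplit v (splitAt m v) refl

copies : (s t n : ℕ) → Fin (n * s + n * t) ↔ (Fin n × Fin (s + t))
copies s t n = (↔-id (Fin n) ×-↔ ↔-sym +↔⊎) ↔-∘ (↔-sym (×-distribˡ-⊎ 0ℓ _ _ _) ↔-∘ ((*↔× ⊎-↔ *↔×) ↔-∘ +↔⊎))

copies-x : ∀ {s t n} (k : Fin n) (i : Fin s) → Inverse.from (copies s t n) (k , i ↑ˡ t) ≡ combine k i ↑ˡ (n * t)
copies-x {s} {t} {n} k i rewrite splitAt-↑ˡ s i t = refl

copies-y : ∀ {s t n} (k : Fin n) (j : Fin t) → Inverse.from (copies s t n) (k , s ↑ʳ j) ≡ (n * s) ↑ʳ combine k j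
copies-y {s} {t} {n} k j rewrite splitAt-↑ʳ s t j = refl

-- The form of remQuot-combine in which S₂ₙ decodes its edge copies.
quotRem-combine : ∀ {m n} (k : Fin m) (e : Fin n) → Fin.quotRem {m} n (combine k e) ≡ (e , k)
quotRem-combine k e = cong swap (remQuot-combine k e)

-- Layer a₁ of one endpoint and a₂ of the other endpoint of an edge in layer a: one endpoint
-- is in the base layer 0, the other in layer a.
Flank : {n : ℕ} → Fin (suc n) → Fin (suc n) → Fin (suc n) → Set
Flank a a₁ a₂ = (a₁ ≡ Fin.zero × a₂ ≡ a) ⊎ (a₁ ≡ a × a₂ ≡ Fin.zero)

module S2nLayers {s t : ℕ} (B : BipGraph s t) (H : Decomposition B) (n : ℕ) where

  G S : Graph
  G = toGraph B
  S = S2n B H n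

  vertexLayers : Fin (p S) ↔ (Fin (p G) × Fin (suc n))
  vertexLayers = stack (copies s t n)

  edgeLayers : Fin (q S) ↔ (Fin (q G) × Fin (suc n))
  edgeLayers = stack *↔×

  layers : Elements S ↔ (Elements G × Fin (suc n))
  layers = ↔-sym (×-distribʳ-⊎ 0ℓ _ _ _) ↔-∘ (vertexLayers ⊎-↔ edgeLayers)

  vertexIn : Fin (p G) → Fin (suc n) → Fin (p S)
  vertexIn u a = Inverse.from vertexLayers (u , a)

  edgeIn : Fin (q G) → Fin (suc n) → Fin (q S)
  edgeIn e a = Inverse.from edgeLayers (e , a)

  -- The copy of the edge x y of G in layer a joins the copies of x and y in flanking layers:
  -- layer 0 is G itself, an H₁-copy joins x to y^k, an H₂-copy joins x^k to y.
  edge-ends : ∀ e a → ∃₂ λ a₁ a₂ → Flank a a₁ a₂ ×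
    ends S (edgeIn e a) ≡ (vertexIn (proj₁ (ends G e)) a₁ , vertexIn (proj₂ (ends G e)) a₂)
  edge-ends e Fin.zero rewrite splitAt-↑ˡ (nE B) e (n * nE B) =
    Fin.zero , Fin.zero , inj₁ (refl , refl) , refl
  edge-ends e (Fin.suc k) with splitAt (nE B) (edgeIn e (Fin.suc k)) | splitAt-↑ʳ (nE B) (n * nE B) (combine k e)
  ... | _ | refl with Fin.quotRem {n} (nE B) (combine k e) | quotRem-combine k e
  ... | _ | refl with H e
  ... | true  = Fin.zero , Fin.suc k , inj₁ (refl , refl) ,
                cong (_ ,_) (cong ((s + t) ↑ʳ_) (sym (copies-y k (proj₂ (BipGraph.edge B e)))))
  ... | false = Fin.suc k , Fin.zero , inj₂ (refl , refl) ,
                cong (_, _) (cong ((s + t) ↑ʳ_) (sym (copies-x k (proj₁ (BipGraph.edge B e)))))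

module ShiftedLabeling {s t : ℕ} (B : BipGraph s t) (H : Decomposition B) (n : ℕ)
                       (f : Labeling (toGraph B)) (d : Fin (suc n)) where
  open S2nLayers B H n

  P : ℕ
  P = p G + q G

  τ ρ : Permutation′ (suc n)
  τ = transpose Fin.zero d
  ρ = τ ∘ₚ reverse

  shift : Elements G → Permutation′ (suc n)
  shift (inj₁ _) = τ
  shift (inj₂ _) = ρ

  L : Labeling S
  L = proj₁ (layeredLabeling G S f layers shift)

  lab-L : ∀ u a → lab S L (Inverse.from layers (u , a)) ≡ P * toℕ (shift u ⟨$⟩ʳ a) + lab G f u
  lab-L = proj₂ (layeredLabeling G S f layers shift)

  toℕ-ρ : ∀ a → toℕ (ρ ⟨$⟩ʳ a) ≡ n ∸ toℕ (τ ⟨$⟩ʳ a)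
  toℕ-ρ a = opposite-prop (τ ⟨$⟩ʳ a)

  -- τ(a₁) + (n - τ(a)) + τ(a₂) = d + n, since {a₁, a₂} = {0, a} and τ(0) = d.
  flank-sum : ∀ {a a₁ a₂} → Flank a a₁ a₂ → toℕ (τ ⟨$⟩ʳ a₁) + toℕ (ρ ⟨$⟩ʳ a) + toℕ (τ ⟨$⟩ʳ a₂) ≡ toℕ d + n
  flank-sum {a} (inj₁ (refl , refl)) = begin
    toℕ d + toℕ (ρ ⟨$⟩ʳ a) + toℕ (τ ⟨$⟩ʳ a)   ≡⟨ +-assoc (toℕ d) _ _ ⟩
    toℕ d + (toℕ (ρ ⟨$⟩ʳ a) + toℕ (τ ⟨$⟩ʳ a)) ≡⟨ cong (λ x → toℕ d + (x + toℕ (τ ⟨$⟩ʳ a))) (toℕ-ρ a) ⟩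
    toℕ d + (n ∸ toℕ (τ ⟨$⟩ʳ a) + toℕ (τ ⟨$⟩ʳ a)) ≡⟨ cong (toℕ d +_) (m∸n+n≡m (toℕ≤pred[n] (τ ⟨$⟩ʳ a))) ⟩
    toℕ d + n                                    ∎
    where open ≡-Reasoning
  flank-sum {a} (inj₂ (refl , refl)) = begin
    toℕ (τ ⟨$⟩ʳ a) + toℕ (ρ ⟨$⟩ʳ a) + toℕ d             ≡⟨ cong (λ x → toℕ (τ ⟨$⟩ʳ a) + x + toℕ d) (toℕ-ρ a) ⟩
    toℕ (τ ⟨$⟩ʳ a) + (n ∸ toℕ (τ ⟨$⟩ʳ a)) + toℕ d     ≡⟨ cong (_+ toℕ d) (m+[n∸m]≡n (toℕ≤pred[n] (τ ⟨$⟩ʳ a))) ⟩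
    n + toℕ d                                          ≡⟨ +-comm n (toℕ d) ⟩
    toℕ d + n                                          ∎
    where open ≡-Reasoning

  shifted-magic : ∀ k → IsEdgeMagic G f k → IsEdgeMagic S L (P * (toℕ d + n) + k)
  shifted-magic k magic e =
    subst (λ e → edgeLabelSum S L e ≡ P * (toℕ d + n) + k) (Inverse.strictlyInverseʳ edgeLayers e)
          (layer-sum (proj₁ (Inverse.to edgeLayers e)) (proj₂ (Inverse.to edgeLayers e)))
    where
    spread : ∀ P A E C x y z → (P * A + x) + (P * E + y) + (P * C + z) ≡ P * (A + E + C) + (x + y + z)
    spread = solve-∀
    layer-sum : ∀ e₀ a → edgeLabelSum S L (edgeIn e₀ a) ≡ P * (toℕ d + n) + k
    layer-sum e₀ a with edge-ends e₀ a
    ... | a₁ , a₂ , flank , ends≡ = begin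
      edgeLabelSum S L (edgeIn e₀ a)
        ≡⟨ cong (λ uv → lab S L (inj₁ (proj₁ uv)) + lab S L (inj₂ (edgeIn e₀ a)) + lab S L (inj₁ (proj₂ uv))) ends≡ ⟩
      lab S L (inj₁ (vertexIn x a₁)) + lab S L (inj₂ (edgeIn e₀ a)) + lab S L (inj₁ (vertexIn y a₂))
        ≡⟨ cong₂ _+_ (cong₂ _+_ (lab-L (inj₁ x) a₁) (lab-L (inj₂ e₀) a)) (lab-L (inj₁ y) a₂) ⟩
      (P * toℕ (τ ⟨$⟩ʳ a₁) + lab G f (inj₁ x)) + (P * toℕ (ρ ⟨$⟩ʳ a) + lab G f (inj₂ e₀))
        + (P * toℕ (τ ⟨$⟩ʳ a₂) + lab G f (inj₁ y))
        ≡⟨ spread P _ _ _ _ _ _ ⟩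
      P * (toℕ (τ ⟨$⟩ʳ a₁) + toℕ (ρ ⟨$⟩ʳ a) + toℕ (τ ⟨$⟩ʳ a₂)) + edgeLabelSum G f e₀
        ≡⟨ cong₂ _+_ (cong (P *_) (flank-sum flank)) (magic e₀) ⟩
      P * (toℕ d + n) + k ∎
      where
      open ≡-Reasoning
      x y : Fin (p G)
      x = proj₁ (ends G e₀)
      y = proj₂ (ends G e₀)

-- For P ≠ 0 the numbers P(d+n) + k, d = 0..n, are pairwise distinct; so a property enjoyed by
-- all of them holds for at least M numbers whenever M ≤ n+1.
affine-AtLeast : ∀ {M n} (P k : ℕ) .{{_ : NonZero P}} {Q : ℕ → Set} → M ≤ suc n →
  (∀ (d : Fin (suc n)) → Q (P * (toℕ d + n) + k)) → AtLeast M Q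
affine-AtLeast {M} {n} P k M≤ allQ = value , value-injective , λ i → allQ (inject≤ i M≤)
  where
  value : Fin M → ℕ
  value i = P * (toℕ (inject≤ i M≤) + n) + k
  value-injective : ∀ {i j} → value i ≡ value j → i ≡ j
  value-injective {i} {j} eq = inject≤-injective M≤ M≤ i j
    (toℕ-injective (+-cancelʳ-≡ n _ _ (*-cancelˡ-≡ _ _ P (+-cancelʳ-≡ k _ _ eq))))

corollary3p8 : ∀ (s t : ℕ) (G : BipGraph s t) (H : Decomposition G) →
    EdgeMagic (toGraph G) →
    ∀ (M : ℕ) → Σ ℕ λ N → ∀ (n : ℕ) → n ≥ N → AtLeast M (InTau (S2n G H n))
corollary3p8 s t G H (f , k , magic) M = M , valences
  where
  -- S₂ₙ has no edges when G has none; otherwise its n+1 shifted labelings give n+1 ≥ M valences.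
  valences : ∀ n → n ≥ M → AtLeast M (InTau (S2n G H n))
  valences n M≤n with nE G ≟ 0
  ... | yes noEdgesG = toℕ , toℕ-injective , λ i →
      edgeless-InTau (S2n G H n) noEdges (ShiftedLabeling.L G H n f Fin.zero) (toℕ i)
    where
    noEdges : q (S2n G H n) ≡ 0
    noEdges = trans (cong (λ m → m + n * m) noEdgesG) (*-zeroʳ n)
  ... | no someEdges =
      affine-AtLeast P k {{nonZero}} {InTau S} (m≤n⇒m≤1+n M≤n) λ d →
        magic⇒InTau S (ShiftedLabeling.L G H n f d) (P * (toℕ d + n) + k)
                    (ShiftedLabeling.shifted-magic G H n f d k magic)
    where
    P : ℕ
    P = s + t + nE G
    S : Graph
    S = S2n G H n
    nonZero : NonZero P
    nonZero = ≢-nonZero λ P≡0 → someEdges (m+n≡0⇒n≡0 (s + t) P≡0)
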